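{- Let $G$ be a graph and $\mathcal{C}=(R,B)$ a configuration of $G$ such that the oriented graph $D=R\cup B$ is Bernstein. Then $\mathcal{C}$ is recoverable.
   Context: A configuration of a graph $G$ (without isolated vertices) is a partition $(R,B)$ (red/blue colouring) of the arcs of some orientation of $G$. Its degree function is $f(\mathcal{C})=(\deg^+_R,\deg^-_R,\deg^+_B,\deg^-_B)$, the tuple of functions on $V(G)$ giving the out- and in-degrees in the red and in the blue arcs. $\mathcal{C}$ is recoverable if no other configuration $\mathcal{C}'$ of $G$ has $f(\mathcal{C}')=f(\mathcal{C})$. An alternating closed trail in an oriented graph is a cyclic sequence of distinct arcs $e_0,\dots,e_{2m}=e_0$ such that (indices mod $2m$) $e_i,e_{i+1}$ share a vertex $v_i$ and are both directed into or both out of $v_i$, and $v_i\ne v_{i+1}$ for each $i$. An oriented graph is Bernstein if it has no directed cycle and no alternating closed trail. -}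

module Defs where

open import Data.Nat using (ℕ; zero; suc; _+_; _*_)
open import Data.Fin using (Fin; zero; suc; _≟_)
open import Data.Bool using (Bool; true; false; _∧_; if_then_else_)
open import Data.Product using (_×_; _,_; proj₁; proj₂; Σ; ∃; swap)
open import Data.Sum using (_⊎_)
open import Function.Definitions using (Injective)
open import Relation.Nullary using (¬_)
open import Relation.Nullary.Decidable using (⌊_⌋)
open import Relation.Binary.PropositionalEquality using (_≡_; _≢_)

record Graph : Set where
  field
    n : ℕ
    m : ℕ
    ends : Fin m → Fin n × Fin n
    noLoop : ∀ e → proj₁ (ends e) ≢ proj₂ (ends e)
    simple : ∀ e e' → (ends e ≡ ends e' ⊎ ends e ≡ swap (ends e')) → e ≡ e'
    noIsolated : ∀ v → ∃ λ e → (proj₁ (ends e) ≡ v ⊎ proj₂ (ends e) ≡ v)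

data Colour : Set where
  red blue : Colour

isRed : Colour → Bool
isRed red = true
isRed blue = false

isBlue : Colour → Bool
isBlue red = false
isBlue blue = true

-- A configuration: for each edge an orientation (true = from proj₁ to proj₂
-- of its ends, false = reverse) and a colour.  This is exactly an
-- orientation of G together with a partition (R , B) of its arcs.
Config : Graph → Set
Config G = Fin (Graph.m G) → Bool × Colour

module _ (G : Graph) where
  open Graph G

  tail : Config G → Fin m → Fin n
  tail C e = if proj₁ (C e) then proj₁ (ends e) else proj₂ (ends e)

  head : Config G → Fin m → Fin n
  head C e = if proj₁ (C e) then proj₂ (ends e) else proj₁ (ends e)

  colour : Config G → Fin m → Colour
  colour C e = proj₂ (C e)

count : ∀ {k} → (Fin k → Bool) → ℕ
count {zero} p = 0
count {suc k} p = (if p zero then 1 else 0) + count (λ i → p (suc i))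

degFun : (G : Graph) → Config G → Fin (Graph.n G) → ℕ × ℕ × ℕ × ℕ
degFun G C v =
    count (λ e → isRed (colour G C e) ∧ ⌊ tail G C e ≟ v ⌋)
  , count (λ e → isRed (colour G C e) ∧ ⌊ head G C e ≟ v ⌋)
  , count (λ e → isBlue (colour G C e) ∧ ⌊ tail G C e ≟ v ⌋)
  , count (λ e → isBlue (colour G C e) ∧ ⌊ head G C e ≟ v ⌋)

Recoverable : (G : Graph) → Config G → Set
Recoverable G C =
  (C' : Config G) → (∀ v → degFun G C' v ≡ degFun G C v) → ∀ e → C' e ≡ C e

next : ∀ {k} → Fin (suc k) → Fin (suc k)
next {zero} zero = zero
next {suc k} zero = suc zero
next {suc k} (suc i) with next {k} i
... | zero = zero
... | suc j = suc (suc j)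

module _ (G : Graph) (C : Config G) where
  open Graph G

  HasDirectedCycle : Set
  HasDirectedCycle =
    Σ ℕ λ k → Σ (Fin (suc k) → Fin m) λ a →
      (∀ i → head G C (a i) ≡ tail G C (a (next i)))
      × Injective _≡_ _≡_ (λ i → tail G C (a i))

  HasAltClosedTrail : Set
  HasAltClosedTrail =
    Σ ℕ λ l → Σ (Fin (suc (suc (l * 2))) → Fin m) λ es →
      Injective _≡_ _≡_ es ×
      Σ (Fin (suc (suc (l * 2))) → Fin n) λ vs →
        (∀ i → ((head G C (es i) ≡ vs i × head G C (es (next i)) ≡ vs i)
                ⊎ (tail G C (es i) ≡ vs i × tail G C (es (next i)) ≡ vs i))
               × vs i ≢ vs (next i))

  Bernstein : Set
  Bernstein = ¬ HasDirectedCycle × ¬ HasAltClosedTrail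

{-# OPTIONS --safe #-}
module Submission where

-- At the head v of an arc
-- reversed in C′ the total in-degree is unchanged, so some other reversed arc
-- must leave v; following reversed arcs in the finite graph closes a directed
-- cycle.  If no arc is reversed, an arc that turns from red to blue lowers the
-- red in-degree at its head, which some arc turning from blue to red must
-- restore; dually, an arc turning from blue to red is compensated at its tail
-- by one turning from red to blue.  Chaining these compensations closes up; the
-- two kinds alternate, so the closed walk has even length, and consecutive
-- arcs meet alternately at heads and at tails, so consecutive meeting points
-- differ: it is an alternating closed trail.  A Bernstein configuration has
-- neither.

open import Defs

open import Data.Bool using (Bool; true; false; T; _∧_; if_then_else_) renaming (_≟_ to _≟ᵇ_)
open import Data.Bool.Properties using (T-∧; ¬-not; if-not)
open import Data.Empty using (⊥; ⊥-elim)
open import Data.Fin using (Fin; zero; suc; toℕ; fromℕ<; _≟_)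
open import Data.Fin.Properties using (any?; pigeonhole; toℕ<n; toℕ-injective; toℕ-fromℕ<)
open import Data.Nat using (ℕ; zero; suc; _+_; _*_; _≤_; _<_; z≤n; s≤s)
open import Data.Nat.Properties
  using (≤-pred; <-irrefl; +-suc; +-identityʳ; +-cancelˡ-≡; +-monoʳ-≤; suc-injective; n<1+n;
         m<1+n⇒m<n∨m≡n; m≤n⇒∃[o]m+o≡n; m≤n⇒m≤1+n; m<n⇒m<1+n)
open import Data.Product using (Σ; ∃; ∃₂; _×_; _,_; proj₁; proj₂)
open import Data.Sum using (_⊎_; inj₁; inj₂)
import Data.Sum as Sum
open import Function using (_∘_; flip; Equivalence)
open import Function.Definitions using (Injective)
open import Relation.Nullary using (¬_; Dec; yes; no)
open import Relation.Nullary.Decidable using (⌊_⌋; toWitness; fromWitness; T?; ¬?; _×-dec_; decidable-stable)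
open import Relation.Binary.PropositionalEquality
  using (_≡_; _≢_; refl; sym; trans; cong; cong₂; subst; subst₂; module ≡-Reasoning)

open Equivalence using (to; from)

count-mono : ∀ {k} {p q : Fin k → Bool} → (∀ i → T (p i) → T (q i)) → count p ≤ count q
count-mono {zero} p⊆q = z≤n
count-mono {suc k} {p} {q} p⊆q with p zero | q zero | p⊆q zero
... | true  | true  | _ = s≤s (count-mono (p⊆q ∘ suc))
... | true  | false | f = ⊥-elim (f _)
... | false | true  | _ = m≤n⇒m≤1+n (count-mono (p⊆q ∘ suc))
... | false | false | _ = count-mono (p⊆q ∘ suc)

count-strict : ∀ {k} {p q : Fin k → Bool} → (∀ i → T (p i) → T (q i)) →
               ∀ j → ¬ T (p j) → T (q j) → count p < count q
count-strict {suc k} {p} {q} p⊆q zero ¬pj qj with p zero | q zero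
... | true  | _     = ⊥-elim (¬pj _)
... | false | true  = s≤s (count-mono (p⊆q ∘ suc))
... | false | false = ⊥-elim qj
count-strict {suc k} {p} {q} p⊆q (suc j) ¬pj qj with p zero | q zero | p⊆q zero
... | true  | true  | _ = s≤s (count-strict (p⊆q ∘ suc) j ¬pj qj)
... | true  | false | f = ⊥-elim (f _)
... | false | true  | _ = m<n⇒m<1+n (count-strict (p⊆q ∘ suc) j ¬pj qj)
... | false | false | _ = count-strict (p⊆q ∘ suc) j ¬pj qj

count-exchange : ∀ {k} (p q : Fin k → Bool) → count p ≡ count q →
                 ∀ j → ¬ T (p j) → T (q j) → ∃ λ i → T (p i) × ¬ T (q i)
count-exchange p q same j ¬pj qj with any? (λ i → T? (p i) ×-dec ¬? (T? (q i)))
... | yes found = found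
... | no none = ⊥-elim (<-irrefl same (count-strict p⊆q j ¬pj qj))
  where
  p⊆q : ∀ i → T (p i) → T (q i)
  p⊆q i pi = decidable-stable (T? (q i)) (λ ¬qi → none (i , pi , ¬qi))

count-split : ∀ {k} (c : Fin k → Colour) (q : Fin k → Bool) →
              count (λ i → isRed (c i) ∧ q i) + count (λ i → isBlue (c i) ∧ q i) ≡ count q
count-split {zero} c q = refl
count-split {suc k} c q with c zero | q zero | count-split (c ∘ suc) (q ∘ suc)
... | red  | true  | eq = cong suc eq
... | red  | false | eq = eq
... | blue | true  | eq = trans (+-suc _ _) (cong suc eq)
... | blue | false | eq = eq

toℕ-next : ∀ {k} (i : Fin (suc k)) → toℕ (next i) ≡ suc (toℕ i) ⊎ (toℕ i ≡ k × next i ≡ zero)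
toℕ-next {zero} zero = inj₂ (refl , refl)
toℕ-next {suc k} zero = inj₁ refl
toℕ-next {suc k} (suc i) with next {k} i | toℕ-next {k} i
... | zero  | inj₂ (i≡k , _) = inj₂ (cong suc i≡k , refl)
... | suc j | inj₁ eq        = inj₁ (cong suc eq)

module FiniteSequence {N : ℕ} (w : ℕ → Fin N) where

  InjectiveBelow : ℕ → Set
  InjectiveBelow j = ∀ {a b} → a < j → b < j → w a ≡ w b → a ≡ b

  Repetition : Set
  Repetition = ∃₂ λ i j → i < j × w i ≡ w j × InjectiveBelow j

  injectiveBelow-suc : ∀ {j} → InjectiveBelow j → (∀ {a} → a < j → w a ≢ w j) →
                       InjectiveBelow (suc j)
  injectiveBelow-suc {j} inj fresh {a} {b} a<1+j b<1+j with m<1+n⇒m<n∨m≡n a<1+j | m<1+n⇒m<n∨m≡n b<1+j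
  ... | inj₁ a<j  | inj₁ b<j  = inj a<j b<j
  ... | inj₁ a<j  | inj₂ refl = ⊥-elim ∘ fresh a<j
  ... | inj₂ refl | inj₁ b<j  = ⊥-elim ∘ fresh b<j ∘ sym
  ... | inj₂ refl | inj₂ refl = λ _ → refl

  ¬injectiveBelow-1+N : ¬ InjectiveBelow (suc N)
  ¬injectiveBelow-1+N inj with pigeonhole (n<1+n N) (w ∘ toℕ)
  ... | i , j , i<j , eq = <-irrefl (inj (toℕ<n i) (toℕ<n j) eq) i<j

  repetition-or-injectiveBelow : ∀ j → Repetition ⊎ InjectiveBelow j
  repetition-or-injectiveBelow zero = inj₂ (λ ())
  repetition-or-injectiveBelow (suc j) with repetition-or-injectiveBelow j
  ... | inj₁ rep = inj₁ rep
  ... | inj₂ inj with any? (λ (i : Fin j) → w (toℕ i) ≟ w j)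
  ...   | yes (i , eq) = inj₁ (toℕ i , j , toℕ<n i , eq , inj)
  ...   | no fresh = inj₂ (injectiveBelow-suc inj λ a<j eq →
                             fresh (fromℕ< a<j , subst (λ a → w a ≡ w j) (sym (toℕ-fromℕ< a<j)) eq))

  repetition : Repetition
  repetition with repetition-or-injectiveBelow (suc N)
  ... | inj₁ rep = rep
  ... | inj₂ inj = ⊥-elim (¬injectiveBelow-1+N inj)

-- The suc k vertices of the cycle are  walk 0 , … , walk k.
record Cycle {X : Set} (R : X → X → Set) (k : ℕ) : Set where
  field
    walk     : ℕ → X
    step     : ∀ a → R (walk a) (walk (suc a))
    closed   : walk (suc k) ≡ walk 0
    distinct : ∀ {a b} → a ≤ k → b ≤ k → walk a ≡ walk b → a ≡ b

  vertex : Fin (suc k) → X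
  vertex t = walk (toℕ t)

  vertex-step : ∀ t → R (vertex t) (vertex (next t))
  vertex-step t with toℕ-next t
  ... | inj₁ eq = subst (R (vertex t) ∘ walk) (sym eq) (step (toℕ t))
  ... | inj₂ (t≡k , next≡0) =
    subst₂ R (cong walk (sym t≡k)) (trans closed (cong vertex (sym next≡0))) (step k)

  vertex-injective : Injective _≡_ _≡_ vertex
  vertex-injective {s} {t} = toℕ-injective ∘ distinct (≤-pred (toℕ<n s)) (≤-pred (toℕ<n t))

infinite-walk : ∀ {X : Set} {R : X → X → Set} → (∀ {x y} → R x y → ∃ (R y)) →
                ∀ {x y} → R x y → ∃ λ (w : ℕ → X) → ∀ a → R (w a) (w (suc a))
infinite-walk {X} {R} serial {x} {y} r = proj₁ ∘ arc , proj₂ ∘ proj₂ ∘ arc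
  where
  arc : ℕ → Σ X λ u → ∃ (R u)
  arc zero    = x , y , r
  arc (suc a) = proj₁ (proj₂ (arc a)) , serial (proj₂ (proj₂ (arc a)))

cycle-in-walk : ∀ {N} {R : Fin N → Fin N → Set} (w : ℕ → Fin N) →
                (∀ a → R (w a) (w (suc a))) → ∃ (Cycle R)
cycle-in-walk {R = R} w steps with FiniteSequence.repetition w
... | i , j , i<j , wi≡wj , inj with m≤n⇒∃[o]m+o≡n i<j
... | k , refl = k , record { walk = w ∘ (i +_) ; step = step ; closed = closed ; distinct = distinct }
  where
  step : ∀ a → R (w (i + a)) (w (i + suc a))
  step a = subst (R (w (i + a)) ∘ w) (sym (+-suc i a)) (steps (i + a))
  closed : w (i + suc k) ≡ w (i + 0)
  closed = trans (cong w (+-suc i k)) (trans (sym wi≡wj) (cong w (sym (+-identityʳ i))))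
  distinct : ∀ {a b} → a ≤ k → b ≤ k → w (i + a) ≡ w (i + b) → a ≡ b
  distinct a≤k b≤k = +-cancelˡ-≡ i _ _ ∘ inj (s≤s (+-monoʳ-≤ i a≤k)) (s≤s (+-monoʳ-≤ i b≤k))

serial-cycle : ∀ {N} {R : Fin N → Fin N → Set} → (∀ {x y} → R x y → ∃ (R y)) →
               ∀ {x y} → R x y → ∃ (Cycle R)
serial-cycle serial r with w , steps ← infinite-walk serial r = cycle-in-walk w steps

module Alternation {X : Set} {R : X → X → Set} {A B : X → Set}
         (alternating : ∀ {x y} → R x y → (A x × B y) ⊎ (B x × A y))
         (disjoint : ∀ {x} → A x → B x → ⊥) where

  A→B : ∀ {x y} → R x y → A x → B y
  A→B r a with alternating r
  ... | inj₁ (_ , b) = b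
  ... | inj₂ (b , _) = ⊥-elim (disjoint a b)

  B→A : ∀ {x y} → R x y → B x → A y
  B→A r b with alternating r
  ... | inj₁ (a , _) = ⊥-elim (disjoint a b)
  ... | inj₂ (_ , a) = a

  module _ {k} (c : Cycle R k) (a₀ : A (Cycle.walk c 0)) where
    open Cycle c

    walk-parity : ∀ a → ∃ λ l → (a ≡ l * 2 × A (walk a)) ⊎ (a ≡ suc (l * 2) × B (walk a))
    walk-parity zero = 0 , inj₁ (refl , a₀)
    walk-parity (suc a) with walk-parity a
    ... | l , inj₁ (refl , x) = l , inj₂ (refl , A→B (step a) x)
    ... | l , inj₂ (refl , y) = suc l , inj₁ (refl , B→A (step a) y)

    even-cycle-from-A : ∃ λ l → k ≡ suc (l * 2)
    even-cycle-from-A with walk-parity (suc k)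
    ... | suc l , inj₁ (eq , _) = l , suc-injective eq
    ... | _ , inj₂ (_ , b) = ⊥-elim (disjoint a₀ (subst B closed b))

alternating-cycle-even : ∀ {X : Set} {R : X → X → Set} {A B : X → Set} →
                         (∀ {x y} → R x y → (A x × B y) ⊎ (B x × A y)) →
                         (∀ {x} → A x → B x → ⊥) →
                         ∀ {k} → Cycle R k → ∃ λ l → k ≡ suc (l * 2)
alternating-cycle-even alternating disjoint c with alternating (Cycle.step c 0)
... | inj₁ (a , _) = Alternation.even-cycle-from-A alternating disjoint c a
... | inj₂ (b , _) = Alternation.even-cycle-from-A (Sum.swap ∘ alternating) (flip disjoint) c b

other : Colour → Colour
other red  = blue
other blue = red

other-involutive : ∀ c → other (other c) ≡ c
other-involutive red  = refl
other-involutive blue = refl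

other≢ : ∀ c → other c ≢ c
other≢ red  ()
other≢ blue ()

≢⇒≡other : ∀ {c d} → d ≢ c → d ≡ other c
≢⇒≡other {red}  {red}  d≢c = ⊥-elim (d≢c refl)
≢⇒≡other {red}  {blue} _   = refl
≢⇒≡other {blue} {red}  _   = refl
≢⇒≡other {blue} {blue} d≢c = ⊥-elim (d≢c refl)

_≟ᶜ_ : (c d : Colour) → Dec (c ≡ d)
red  ≟ᶜ red  = yes refl
red  ≟ᶜ blue = no λ ()
blue ≟ᶜ red  = no λ ()
blue ≟ᶜ blue = yes refl

is : Colour → Colour → Bool
is red  = isRed
is blue = isBlue

is-sound : ∀ c {d} → T (is c d) → d ≡ c
is-sound red  {red}  _ = refl
is-sound blue {blue} _ = refl

is-complete : ∀ {c d} → d ≡ c → T (is c d)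
is-complete {red}  refl = _
is-complete {blue} refl = _

orientation : (G : Graph) → Config G → Fin (Graph.m G) → Bool
orientation G C e = proj₁ (C e)

-- The end at which a change of colour c is compensated.  Red and blue use
-- opposite ends so that consecutive meeting points of the trail differ.
end : (G : Graph) → Config G → Colour → Fin (Graph.m G) → Fin (Graph.n G)
end G C red  = head G C
end G C blue = tail G C

module Reorientation (G : Graph) (C C′ : Config G) where
  open Graph G

  head-same : ∀ {e} → orientation G C′ e ≡ orientation G C e → head G C′ e ≡ head G C e
  head-same {e} = cong (λ b → if b then proj₂ (ends e) else proj₁ (ends e))

  tail-same : ∀ {e} → orientation G C′ e ≡ orientation G C e → tail G C′ e ≡ tail G C e
  tail-same {e} = cong (λ b → if b then proj₁ (ends e) else proj₂ (ends e))

  head-reversed : ∀ {e} → orientation G C′ e ≢ orientation G C e → head G C′ e ≡ tail G C e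
  head-reversed {e} rev =
    trans (cong (λ b → if b then proj₂ (ends e) else proj₁ (ends e)) (¬-not rev)) (if-not (orientation G C e))

  head≢tail : ∀ e → head G C e ≢ tail G C e
  head≢tail e = ends-differ (orientation G C e)
    where
    ends-differ : ∀ b → (if b then proj₂ (ends e) else proj₁ (ends e))
                      ≢ (if b then proj₁ (ends e) else proj₂ (ends e))
    ends-differ true  = noLoop e ∘ sym
    ends-differ false = noLoop e

  end-other : ∀ c e → end G C c e ≢ end G C (other c) e
  end-other red  e = head≢tail e
  end-other blue e = head≢tail e ∘ sym

module SameDegrees (G : Graph) (C C′ : Config G) (same-degrees : ∀ v → degFun G C′ v ≡ degFun G C v) where
  open Graph G
  open Reorientation G C C′

  hd tl : Fin m → Fin n
  hd = head G C
  tl = tail G C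

  col col′ : Fin m → Colour
  col  = colour G C
  col′ = colour G C′

  in-degree-preserved : ∀ v → count (λ e → ⌊ head G C′ e ≟ v ⌋) ≡ count (λ e → ⌊ hd e ≟ v ⌋)
  in-degree-preserved v =
    trans (sym (count-split col′ _))
          (trans (cong₂ _+_ (cong (proj₁ ∘ proj₂) (same-degrees v))
                            (cong (proj₂ ∘ proj₂ ∘ proj₂) (same-degrees v)))
                 (count-split col _))

  colour-degree-preserved : ∀ c v → count (λ e → is c (col′ e) ∧ ⌊ end G C′ c e ≟ v ⌋)
                                  ≡ count (λ e → is c (col e) ∧ ⌊ end G C c e ≟ v ⌋)
  colour-degree-preserved red  v = cong (proj₁ ∘ proj₂) (same-degrees v)
  colour-degree-preserved blue v = cong (proj₁ ∘ proj₂ ∘ proj₂) (same-degrees v)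

  Reversed : Fin m → Set
  Reversed e = orientation G C′ e ≢ orientation G C e

  reversal-continues : ∀ {e} → Reversed e → ∃ λ e′ → Reversed e′ × tl e′ ≡ hd e
  reversal-continues {e} rev
    with i , enters′ , ¬enters ←
           count-exchange (λ i → ⌊ head G C′ i ≟ hd e ⌋) (λ i → ⌊ hd i ≟ hd e ⌋)
                          (in-degree-preserved (hd e)) e
                          (λ enters′ → head≢tail e (trans (sym (toWitness enters′)) (head-reversed rev)))
                          (fromWitness refl)
    = i , reversed , trans (sym (head-reversed reversed)) (toWitness enters′)
    where
    reversed : Reversed i
    reversed same = ¬enters (fromWitness (trans (sym (head-same same)) (toWitness enters′)))

  ReversedArc : Fin n → Fin n → Set
  ReversedArc u v = ∃ λ e → Reversed e × tl e ≡ u × hd e ≡ v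

  reversed-arcs-continue : ∀ {u v} → ReversedArc u v → ∃ (ReversedArc v)
  reversed-arcs-continue (_ , rev , _ , refl) with e′ , rev′ , t ← reversal-continues rev =
    hd e′ , e′ , rev′ , t , refl

  directed-cycle : ∀ {k} → Cycle ReversedArc k → HasDirectedCycle G C
  directed-cycle {k} c = k , arc , linked , tails-injective
    where
    open Cycle c
    arc : Fin (suc k) → Fin m
    arc t = proj₁ (vertex-step t)
    tail-arc : ∀ t → tl (arc t) ≡ vertex t
    tail-arc t = proj₁ (proj₂ (proj₂ (vertex-step t)))
    linked : ∀ t → hd (arc t) ≡ tl (arc (next t))
    linked t = trans (proj₂ (proj₂ (proj₂ (vertex-step t)))) (sym (tail-arc (next t)))
    tails-injective : Injective _≡_ _≡_ (tl ∘ arc)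
    tails-injective {s} {t} eq = vertex-injective (trans (sym (tail-arc s)) (trans eq (tail-arc t)))

  reversal⇒directed-cycle : ∀ {e} → Reversed e → HasDirectedCycle G C
  reversal⇒directed-cycle rev = directed-cycle (proj₂ (serial-cycle reversed-arcs-continue (_ , rev , refl , refl)))

  module SameOrientation (same-orientation : ∀ e → orientation G C′ e ≡ orientation G C e) where

    end-same : ∀ c e → end G C′ c e ≡ end G C c e
    end-same red  e = head-same (same-orientation e)
    end-same blue e = tail-same (same-orientation e)

    Recoloured : Colour → Fin m → Set
    Recoloured c e = col e ≡ c × col′ e ≡ other c

    recoloured : ∀ {e} → col′ e ≢ col e → Recoloured (col e) e
    recoloured changed = refl , ≢⇒≡other changed

    recoloured-partner : ∀ c {e} → Recoloured c e →
                         ∃ λ i → Recoloured (other c) i × end G C c e ≡ end G C c i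
    recoloured-partner c {e} (had , lost)
      with i , gains , ¬had ← count-exchange (λ i → is c (col′ i) ∧ ⌊ end G C′ c i ≟ end G C c e ⌋)
                                             (λ i → is c (col i) ∧ ⌊ end G C c i ≟ end G C c e ⌋)
                                             (colour-degree-preserved c (end G C c e)) e
                                             (other≢ c ∘ trans (sym lost) ∘ is-sound c ∘ proj₁ ∘ to T-∧)
                                             (from T-∧ (is-complete had , fromWitness refl))
      with gains-colour , at-end′ ← to T-∧ gains
      = i , (≢⇒≡other lost-colour , trans (is-sound c gains-colour) (sym (other-involutive c))) , sym at-end
      where
      at-end : end G C c i ≡ end G C c e
      at-end = trans (sym (end-same c i)) (toWitness at-end′)
      lost-colour : col i ≢ c
      lost-colour had-c = ¬had (from T-∧ (is-complete had-c , fromWitness at-end))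

    Compensates : Fin m → Fin m → Set
    Compensates e e′ =
      Σ Colour λ c → Recoloured c e × Recoloured (other c) e′ × end G C c e ≡ end G C c e′

    compensations-continue : ∀ {e e′} → Compensates e e′ → ∃ (Compensates e′)
    compensations-continue (c , _ , r′ , _) with i , rᵢ , shared ← recoloured-partner (other c) r′ =
      i , other c , r′ , rᵢ , shared

    compensations-alternate : ∀ {e e′} → Compensates e e′ →
      (Recoloured red e × Recoloured blue e′) ⊎ (Recoloured blue e × Recoloured red e′)
    compensations-alternate (red  , r , r′ , _) = inj₁ (r , r′)
    compensations-alternate (blue , r , r′ , _) = inj₂ (r , r′)

    recolourings-disjoint : ∀ {e} → Recoloured red e → Recoloured blue e → ⊥
    recolourings-disjoint (r , _) (b , _) with trans (sym r) b
    ... | ()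

    pivot : Fin m → Fin n
    pivot e = end G C (col e) e

    pivot-colour : ∀ {c e} → col e ≡ c → pivot e ≡ end G C c e
    pivot-colour {e = e} = cong (λ c → end G C c e)

    compensation-shares-pivot : ∀ {e e′} → Compensates e e′ →
      (hd e ≡ pivot e × hd e′ ≡ pivot e) ⊎ (tl e ≡ pivot e × tl e′ ≡ pivot e)
    compensation-shares-pivot (red  , (had , _) , _ , shared) =
      inj₁ (sym (pivot-colour had) , trans (sym shared) (sym (pivot-colour had)))
    compensation-shares-pivot (blue , (had , _) , _ , shared) =
      inj₂ (sym (pivot-colour had) , trans (sym shared) (sym (pivot-colour had)))

    compensation-pivots-differ : ∀ {e e′} → Compensates e e′ → pivot e ≢ pivot e′
    compensation-pivots-differ {e} {e′} (c , (had , _) , (had′ , _) , shared) same-pivot =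
      end-other c e′ (begin
        end G C c e′         ≡⟨ sym shared ⟩
        end G C c e          ≡⟨ sym (pivot-colour had) ⟩
        pivot e              ≡⟨ same-pivot ⟩
        pivot e′             ≡⟨ pivot-colour had′ ⟩
        end G C (other c) e′ ∎)
      where open ≡-Reasoning

    alternating-trail : ∀ {l} → Cycle Compensates (suc (l * 2)) → HasAltClosedTrail G C
    alternating-trail {l} c =
      l , vertex , vertex-injective , pivot ∘ vertex ,
      λ t → compensation-shares-pivot (vertex-step t) , compensation-pivots-differ (vertex-step t)
      where open Cycle c

    recolouring⇒alternating-trail : ∀ {c e} → Recoloured c e → HasAltClosedTrail G C
    recolouring⇒alternating-trail {c} r
      with i , rᵢ , shared ← recoloured-partner c r
      with k , cycle ← serial-cycle compensations-continue (c , r , rᵢ , shared)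
      with l , refl ← alternating-cycle-even compensations-alternate recolourings-disjoint cycle
      = alternating-trail {l} cycle

lemma2p4 : (G : Graph) (C : Config G) → Bernstein G C → Recoverable G C
lemma2p4 G C (acyclic , trail-free) C′ same-degrees e = cong₂ _,_ (orientation-kept e) colour-kept
  where
  open SameDegrees G C C′ same-degrees
  orientation-kept : ∀ e → orientation G C′ e ≡ orientation G C e
  orientation-kept e =
    decidable-stable (orientation G C′ e ≟ᵇ orientation G C e) (acyclic ∘ reversal⇒directed-cycle)
  open SameOrientation orientation-kept
  colour-kept : colour G C′ e ≡ colour G C e
  colour-kept =
    decidable-stable (colour G C′ e ≟ᶜ colour G C e) (trail-free ∘ recolouring⇒alternating-trail ∘ recoloured)
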